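{- For $n>0$, the number of regular elements of the Heyting algebra $\mathcal{D}_n^B$ is $2^{n}$.
   Context: $D_n^B$ is the set of words of length $2n$ over $\{u,r\}$ in which every prefix contains at least as many $u$'s as $r$'s. Height sequence of $w\in D_n^B$: let $\rho$ be the number of $r$'s. If $w$ ends with $r$, $k=\rho$ and $h_i$ is the number of $u$'s preceding the $i$-th $r$; if $w$ ends with $u$, $k=\rho+1$, $h_i$ ($i\le\rho$) as before and $h_k$ is the total number of $u$'s. Dominance order: $(h_1,\dots,h_k)\le_D(h'_1,\dots,h'_{k'})$ iff $k\ge k'$ and $h_i\le h'_i$ for $i\in[k']$. $\mathcal{D}_n^B=(D_n^B,\le_D)$ is a finite distributive lattice, hence a Heyting algebra. The pseudocomplement $x^{\mathsf c}$ is the greatest $z$ with $x\wedge z=\hat0$; $x$ is regular if $(x^{\mathsf c})^{\mathsf c}=x$. -}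

module Defs where

open import Data.Nat using (ℕ; zero; suc; _≤_; _*_)
open import Data.List using (List; []; _∷_; length; take)
open import Data.Product using (_×_; Σ)
open import Data.Unit using (⊤)
open import Data.Empty using (⊥)
open import Relation.Binary.PropositionalEquality using (_≡_)

-- Letters: u (up) and r (right)
data Letter : Set where
  u r : Letter

#u : List Letter → ℕ
#u []       = zero
#u (u ∷ w) = suc (#u w)
#u (r ∷ w) = #u w

#r : List Letter → ℕ
#r []       = zero
#r (u ∷ w) = #r w
#r (r ∷ w) = suc (#r w)

Ballot : List Letter → Set
Ballot w = ∀ k → #r (take k w) ≤ #u (take k w)

InD : ℕ → List Letter → Set
InD n w = (length w ≡ 2 * n) × Ballot w

-- Height sequence.  go c w: c = number of u's read so far.
-- Each r contributes the current u-count; if the word ends with u,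
-- a final entry equal to the total number of u's is appended.
heightGo : ℕ → List Letter → List ℕ
heightGo c []            = []
heightGo c (u ∷ [])      = suc c ∷ []
heightGo c (u ∷ x ∷ w)  = heightGo (suc c) (x ∷ w)
heightGo c (r ∷ w)       = c ∷ heightGo c w

height : List Letter → List ℕ
height w = heightGo zero w

-- Dominance order on height sequences:
-- h ≤ h' iff length h ≥ length h' and h_i ≤ h'_i for all i ≤ length h'.
Dom : List ℕ → List ℕ → Set
Dom h        []        = ⊤
Dom []       (_ ∷ _)   = ⊥
Dom (a ∷ h) (b ∷ h')  = (a ≤ b) × Dom h h'

_≤D_ : List Letter → List Letter → Set
w ≤D w' = Dom (height w) (height w')

-- x ∧ z = 0̂ in (D_n^B, ≤D): every common lower bound of x and z in D_n^B
-- is the least element, i.e. lies below every element of D_n^B.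
MeetIsBottom : ℕ → List Letter → List Letter → Set
MeetIsBottom n x z =
  ∀ y → InD n y → y ≤D x → y ≤D z → ∀ t → InD n t → y ≤D t

IsPseudocomplement : ℕ → List Letter → List Letter → Set
IsPseudocomplement n x c =
  InD n c × MeetIsBottom n x c × (∀ z → InD n z → MeetIsBottom n x z → z ≤D c)

-- x is regular: (x^c)^c = x
Regular : ℕ → List Letter → Set
Regular n x = Σ (List Letter) λ c →
  IsPseudocomplement n x c × IsPseudocomplement n c x

-- The height sequence h of a word of D_n^B satisfies hᵢ ≥ i; call position i tight when
-- hᵢ = i (a missing entry is not tight), and let σ(x) ⊆ [n] be the set of tight positions.
-- σ is antitone, a word tight everywhere is the bottom (ur)ⁿ, and loosening one position of
-- (ur)ⁿ gives an atom; hence x ∧ z = 0̂ iff every position is tight in x or in z, i.e.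
-- ∁σ(x) ⊆ σ(z). For every T ⊆ [n] there is a greatest word ρ(T) with T ⊆ σ(ρ(T)), and in
-- fact σ(ρ(T)) = T. So x^c = ρ(∁σ(x)), the regular elements are exactly the ρ(T), and ρ is
-- injective, which gives 2ⁿ of them.

module Submission where

open import Defs
open import Data.Nat using (ℕ; zero; suc; pred; _+_; _*_; _^_; _≤_; _<_; z≤n; s≤s; s≤s⁻¹; _≡ᵇ_)
open import Data.Nat.Properties
open import Data.Bool using (Bool; true; false; not; T)
import Data.Bool as B
import Data.Bool.Properties as B
open import Data.List.Relation.Binary.Pointwise using (Pointwise; []; _∷_)
open import Relation.Nullary using (¬_)
open import Function using (_∘_; Equivalence; _⇔_; mk⇔)
open import Data.List using (List; []; _∷_; length; take; drop; _++_; replicate; map)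
open import Data.List.Properties using (length-++; length-replicate; ++-identityʳ; length-map; map-∘; map-cong; map-id; ∷-injectiveʳ)
open import Data.List.Membership.Propositional using (_∈_)
open import Data.List.Membership.Propositional.Properties using (∈-map⁻; ∈-map⁺; ∈-++⁺ˡ; ∈-++⁺ʳ; ∈-++⁻)
open import Data.List.Relation.Unary.Any using (here)
open import Data.List.Relation.Unary.Unique.Propositional using (Unique)
import Data.List.Relation.Unary.Unique.Propositional.Properties as Unique
import Data.List.Relation.Binary.Pointwise as Pointwise
open import Data.List.Relation.Unary.All as All using (All; []; _∷_)
open import Data.List.Relation.Unary.AllPairs using (AllPairs; []; _∷_)
open import Data.Sum using (inj₁; inj₂)
open import Data.Product using (Σ; _×_; _,_; proj₁)
open import Data.Unit using (⊤; tt)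
open import Data.Empty using (⊥; ⊥-elim)
open import Relation.Binary.PropositionalEquality
open ≡-Reasoning
open import Data.Nat.Tactic.RingSolver using (solve-∀)

-- Balanced words

Balanced : ℕ → List Letter → Set
Balanced d       []      = ⊤
Balanced d       (u ∷ w) = Balanced (suc d) w
Balanced zero    (r ∷ w) = ⊥
Balanced (suc d) (r ∷ w) = Balanced d w

PrefixBalanced : ℕ → List Letter → Set
PrefixBalanced d w = ∀ k → #r (take k w) ≤ d + #u (take k w)

balanced⇒prefixBalanced : ∀ d w → Balanced d w → PrefixBalanced d w
balanced⇒prefixBalanced d       []      _ zero    = z≤n
balanced⇒prefixBalanced d       []      _ (suc k) = z≤n
balanced⇒prefixBalanced d       (u ∷ w) _ zero    = z≤n
balanced⇒prefixBalanced d       (u ∷ w) b (suc k) =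
  subst (#r (take k w) ≤_) (sym (+-suc d _)) (balanced⇒prefixBalanced (suc d) w b k)
balanced⇒prefixBalanced (suc d) (r ∷ w) _ zero    = z≤n
balanced⇒prefixBalanced (suc d) (r ∷ w) b (suc k) = s≤s (balanced⇒prefixBalanced d w b k)

prefixBalanced⇒balanced : ∀ d w → PrefixBalanced d w → Balanced d w
prefixBalanced⇒balanced d       []      _ = tt
prefixBalanced⇒balanced d       (u ∷ w) b =
  prefixBalanced⇒balanced (suc d) w λ k → subst (#r (take k w) ≤_) (+-suc d _) (b (suc k))
prefixBalanced⇒balanced zero    (r ∷ w) b with b 1
... | ()
prefixBalanced⇒balanced (suc d) (r ∷ w) b = prefixBalanced⇒balanced d w λ k → s≤s⁻¹ (b (suc k))

-- Height sequences

AboveDiagonal : ℕ → List ℕ → Set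
AboveDiagonal p []      = ⊤
AboveDiagonal p (a ∷ h) = p < a × AboveDiagonal (suc p) h

-- hᵢ ≤ B ∸ i for every (0-based) i, and the last entry is at least B ∸ i ∸ 1: for the
-- height sequence of a word of length B this is letter counting.
Antidiagonal : ℕ → List ℕ → Set
Antidiagonal B []          = ⊤
Antidiagonal B (a ∷ [])    = a ≤ B × B ≤ suc a
Antidiagonal B (a ∷ b ∷ h) = a ≤ B × Antidiagonal (pred B) (b ∷ h)

antidiagonal-∷ : ∀ {a B} h → a ≤ B → (h ≡ [] → B ≤ suc a) → Antidiagonal (pred B) h →
  Antidiagonal B (a ∷ h)
antidiagonal-∷ []      a≤B last _ = a≤B , last refl
antidiagonal-∷ (_ ∷ _) a≤B _    A = a≤B , A

antidiagonal-head : ∀ {a B} h → Antidiagonal B (a ∷ h) → a ≤ B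
antidiagonal-head []      (a≤B , _) = a≤B
antidiagonal-head (_ ∷ _) (a≤B , _) = a≤B

antidiagonal-tail : ∀ {a B} h → Antidiagonal B (a ∷ h) → Antidiagonal (pred B) h
antidiagonal-tail []      _       = tt
antidiagonal-tail (_ ∷ _) (_ , A) = A

antidiagonal-++ : ∀ {B} h₁ h₂ → Antidiagonal (length h₁ + B) (h₁ ++ h₂) → Antidiagonal B h₂
antidiagonal-++ []       h₂ A = A
antidiagonal-++ (a ∷ h₁) h₂ A = antidiagonal-++ h₁ h₂ (antidiagonal-tail (h₁ ++ h₂) A)

antidiagonal-last : ∀ {v B} h → 0 < length h → All (_≤ v) h → Antidiagonal B h → B ≤ length h + v
antidiagonal-last (a ∷ []) _ (a≤v ∷ _) (_ , B≤1+a) = ≤-trans B≤1+a (s≤s a≤v)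
antidiagonal-last {B = B} (a ∷ b ∷ h) _ (_ ∷ ≤v) (_ , A) =
  ≤-trans (m≤suc[pred[m]] B) (s≤s (antidiagonal-last (b ∷ h) (s≤s z≤n) ≤v A))
  where
  m≤suc[pred[m]] : ∀ m → m ≤ suc (pred m)
  m≤suc[pred[m]] zero    = z≤n
  m≤suc[pred[m]] (suc m) = ≤-refl

antidiagonal-slack : ∀ {v} l h → 0 < length h → All (_≤ v) h → Antidiagonal (length h + (v + 2 * l)) h → l ≡ 0
antidiagonal-slack {v} l h nonempty ≤v A =
  m+n≡0⇒m≡0 l (n≤0⇒n≡0 (+-cancelˡ-≤ v (2 * l) 0
    (≤-trans (+-cancelˡ-≤ (length h) _ _ (antidiagonal-last h nonempty ≤v A)) (≤-reflexive (sym (+-identityʳ v))))))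

heightGo-≡[] : ∀ {c} w → heightGo c w ≡ [] → w ≡ []
heightGo-≡[] []          _ = refl
heightGo-≡[] (u ∷ x ∷ w) e with heightGo-≡[] (x ∷ w) e
... | ()

heightGo-aboveDiagonal : ∀ q c d w → Balanced d w → q + d ≡ c → AboveDiagonal q (heightGo c w)
heightGo-aboveDiagonal q c d       []          _ _ = tt
heightGo-aboveDiagonal q c d       (u ∷ [])    _ e = s≤s (subst (q ≤_) e (m≤m+n q d)) , tt
heightGo-aboveDiagonal q c d       (u ∷ x ∷ w) b e =
  heightGo-aboveDiagonal q (suc c) (suc d) (x ∷ w) b (trans (+-suc q d) (cong suc e))
heightGo-aboveDiagonal q c (suc d) (r ∷ w)     b e =
  subst (q <_) e (m<m+n q (s≤s z≤n)) , heightGo-aboveDiagonal (suc q) c d w b (trans (sym (+-suc q d)) e)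

heightGo-≥ : ∀ c w → All (c ≤_) (heightGo c w)
heightGo-≥ c []          = []
heightGo-≥ c (u ∷ [])    = n≤1+n c ∷ []
heightGo-≥ c (u ∷ x ∷ w) = All.map (≤-trans (n≤1+n c)) (heightGo-≥ (suc c) (x ∷ w))
heightGo-≥ c (r ∷ w)     = ≤-refl ∷ heightGo-≥ c w

heightGo-sorted : ∀ c w → AllPairs _≤_ (heightGo c w)
heightGo-sorted c []          = []
heightGo-sorted c (u ∷ [])    = [] ∷ []
heightGo-sorted c (u ∷ x ∷ w) = heightGo-sorted (suc c) (x ∷ w)
heightGo-sorted c (r ∷ w)     = heightGo-≥ c w ∷ heightGo-sorted c w

heightGo-antidiagonal : ∀ c w → Antidiagonal (c + length w) (heightGo c w)
heightGo-antidiagonal c []          = tt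
heightGo-antidiagonal c (u ∷ [])    = ≤-reflexive (+-comm 1 c) , m≤n⇒m≤1+n (≤-reflexive (+-comm c 1))
heightGo-antidiagonal c (u ∷ x ∷ w) =
  subst (λ B → Antidiagonal B (heightGo (suc c) (x ∷ w))) (sym (+-suc c _)) (heightGo-antidiagonal (suc c) (x ∷ w))
heightGo-antidiagonal c (r ∷ w)     = antidiagonal-∷ (heightGo c w) (m≤m+n c _) last
  (subst (λ B → Antidiagonal B (heightGo c w)) (sym (cong pred (+-suc c (length w)))) (heightGo-antidiagonal c w))
  where
  last : heightGo c w ≡ [] → c + suc (length w) ≤ suc c
  last e rewrite heightGo-≡[] w e = ≤-reflexive (+-comm c 1)

heightGo-length : ∀ c d w → Balanced d w → 2 * length (heightGo c w) ≤ suc (length w + d)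
heightGo-length c d       []          _ = z≤n
heightGo-length c d       (u ∷ [])    _ = s≤s (s≤s z≤n)
heightGo-length c d       (u ∷ x ∷ w) b =
  subst (λ k → 2 * length (heightGo (suc c) (x ∷ w)) ≤ suc k) (+-suc (length (x ∷ w)) d)
    (heightGo-length (suc c) (suc d) (x ∷ w) b)
heightGo-length c (suc d) (r ∷ w)     b =
  subst (_≤ suc (suc (length w + suc d))) (sym (*-suc 2 (length (heightGo c w))))
    (s≤s (s≤s (≤-trans (heightGo-length c d w b) (≤-reflexive (sym (+-suc (length w) d))))))

half-≤ : ∀ {k n} → 2 * k ≤ suc (2 * n) → k ≤ n
half-≤ {k} {n} p = s≤s⁻¹ (*-cancelˡ-< 2 k (suc n) (subst (2 * k <_) (sym (*-suc 2 n)) (s≤s p)))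

AboveStaircase : ℕ → ℕ → List ℕ → Set
AboveStaircase k       p []      = ⊤
AboveStaircase zero    p (_ ∷ _) = ⊥
AboveStaircase (suc k) p (a ∷ h) = p < a × AboveStaircase k (suc p) h

aboveStaircase : ∀ {k p} h → AboveDiagonal p h → length h ≤ k → AboveStaircase k p h
aboveStaircase         []      _            _         = tt
aboveStaircase {suc k} (a ∷ h) (p<a , above) (s≤s len) = p<a , aboveStaircase h above len

height-aboveStaircase : ∀ {n w} → InD n w → AboveStaircase n 0 (height w)
height-aboveStaircase {n} {w} (len , ballot) =
  aboveStaircase (height w) (heightGo-aboveDiagonal 0 0 0 w balanced refl)
    (half-≤ (subst (λ m → 2 * length (height w) ≤ suc m) (trans (+-identityʳ _) len)
      (heightGo-length 0 0 w balanced)))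
  where
  balanced : Balanced 0 w
  balanced = prefixBalanced⇒balanced 0 w ballot

height-antidiagonal : ∀ {n w} → InD n w → Antidiagonal (2 * n) (height w)
height-antidiagonal {w = w} (len , _) = subst (λ B → Antidiagonal B (height w)) len (heightGo-antidiagonal 0 w)

-- The signature of tight positions

tight : ℕ → List ℕ → Bool
tight p []      = false
tight p (a ∷ _) = a ≡ᵇ suc p

tightness : ℕ → ℕ → List ℕ → List Bool
tightness zero    p h = []
tightness (suc k) p h = tight p h ∷ tightness k (suc p) (drop 1 h)

σ : ℕ → List Letter → List Bool
σ n w = tightness n 0 (height w)

infix 4 _⊆_
_⊆_ : List Bool → List Bool → Set
_⊆_ = Pointwise B._≤_

∁ : List Bool → List Bool
∁ = map not

length-tightness : ∀ k p h → length (tightness k p h) ≡ k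
length-tightness zero    p h = refl
length-tightness (suc k) p h = cong suc (length-tightness k (suc p) (drop 1 h))

length-σ : ∀ n w → length (σ n w) ≡ n
length-σ n w = length-tightness n 0 (height w)

⊆-refl : ∀ {a} → a ⊆ a
⊆-refl = Pointwise.refl B.≤-refl

≡ᵇ-true : ∀ {a b} → (a ≡ᵇ b) ≡ true → a ≡ b
≡ᵇ-true {a} {b} e = ≡ᵇ⇒≡ a b (Equivalence.from B.T-≡ e)

≡ᵇ-false : ∀ {a b} → (a ≡ᵇ b) ≡ false → a ≢ b
≡ᵇ-false {a} {b} e a≡b = subst T e (≡⇒≡ᵇ a b a≡b)

≡⇒≡ᵇ-true : ∀ {a b} → a ≡ b → (a ≡ᵇ b) ≡ true
≡⇒≡ᵇ-true {a} {b} a≡b = Equivalence.to B.T-≡ (≡⇒≡ᵇ a b a≡b)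

≢⇒≡ᵇ-false : ∀ {a b} → a ≢ b → (a ≡ᵇ b) ≡ false
≢⇒≡ᵇ-false a≢b = B.¬-not (a≢b ∘ ≡ᵇ-true)

≡ᵇ-antitone : ∀ {p a b} → b ≤ a → p < b → (a ≡ᵇ suc p) B.≤ (b ≡ᵇ suc p)
≡ᵇ-antitone {p} {a} {b} b≤a p<b with a ≡ᵇ suc p in eq
... | false = B.≤-minimum _
... | true  = B.≤-reflexive (sym (≡⇒≡ᵇ-true (≤-antisym (subst (b ≤_) (≡ᵇ-true eq) b≤a) p<b)))

tightness-antitone : ∀ k p {x y} → Dom y x → AboveStaircase k p y → tightness k p x ⊆ tightness k p y
tightness-antitone zero    p                 _         _             = []
tightness-antitone (suc k) p {[]}    {[]}    _         _             =
  B.≤-refl ∷ tightness-antitone k (suc p) {[]} {[]} tt tt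
tightness-antitone (suc k) p {[]}    {b ∷ y} _         (_ , above)   =
  B.≤-minimum _ ∷ tightness-antitone k (suc p) {[]} {y} tt above
tightness-antitone (suc k) p {a ∷ x} {b ∷ y} (b≤a , D) (p<b , above) =
  ≡ᵇ-antitone b≤a p<b ∷ tightness-antitone k (suc p) D above

allTight⇒least : ∀ k p y t → All T (tightness k p y) → AboveStaircase k p t → Dom y t
allTight⇒least k       p y       []      _            _             = tt
allTight⇒least (suc k) p []      (c ∷ t) (() ∷ _)     _
allTight⇒least (suc k) p (b ∷ y) (c ∷ t) (tight ∷ ts) (p<c , above) =
  subst (_≤ c) (sym (≡ᵇ⇒≡ b (suc p) tight)) p<c , allTight⇒least k (suc p) y t ts above

true≤⇒≡true : ∀ {b} → true B.≤ b → b ≡ true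
true≤⇒≡true B.b≤b = refl

∁-involutive : ∀ a → ∁ (∁ a) ≡ a
∁-involutive a = trans (sym (map-∘ a)) (trans (map-cong B.not-involutive a) (map-id a))

∁-⊆-swap : ∀ {a b} → ∁ a ⊆ b → ∁ b ⊆ a
∁-⊆-swap {[]}        []            = []
∁-⊆-swap {true ∷ _}  (_     ∷ ∁ab) = B.≤-maximum _ ∷ ∁-⊆-swap ∁ab
∁-⊆-swap {false ∷ _} (B.b≤b ∷ ∁ab) = B.b≤b ∷ ∁-⊆-swap ∁ab

∁⊆⇒upper-bound-full : ∀ {a b c} → ∁ a ⊆ b → a ⊆ c → b ⊆ c → All T c
∁⊆⇒upper-bound-full {[]}        []            []           []           = []
∁⊆⇒upper-bound-full {true ∷ _}  (_     ∷ ∁ab) (B.b≤b ∷ ac) (_     ∷ bc) = tt ∷ ∁⊆⇒upper-bound-full ∁ab ac bc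
∁⊆⇒upper-bound-full {false ∷ _} (B.b≤b ∷ ∁ab) (_     ∷ ac) (B.b≤b ∷ bc) = tt ∷ ∁⊆⇒upper-bound-full ∁ab ac bc

-- The bottom, the atoms and the meet

bottom : ℕ → List Letter
bottom zero    = []
bottom (suc m) = u ∷ r ∷ bottom m

-- (ur)^(m+1) with position 0 loosened: its first r is swapped with the following u.
atom₀ : ℕ → List Letter
atom₀ zero    = u ∷ u ∷ []
atom₀ (suc m) = u ∷ u ∷ r ∷ r ∷ bottom m

atom : ℕ → ℕ → List Letter
atom zero    i       = []
atom (suc m) zero    = atom₀ m
atom (suc m) (suc i) = u ∷ r ∷ atom m i

bottom-least : ∀ q m t → AboveStaircase m q t → Dom (heightGo q (bottom m)) t
bottom-least q m       []      _             = tt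
bottom-least q (suc m) (a ∷ t) (q<a , above) = q<a , bottom-least (suc q) m t above

<-loose : ∀ {p a} → p < a → (a ≡ᵇ suc p) ≡ false → suc p < a
<-loose p<a loose = ≤∧≢⇒< p<a (λ e → ≡ᵇ-false loose (sym e))

loose⇒atom≤ : ∀ m p h → AboveStaircase (suc m) p h → tight p h ≡ false →
  Dom (heightGo p (atom (suc m) zero)) h
loose⇒atom≤ m       p []          _                     _     = tt
loose⇒atom≤ zero    p (a ∷ [])    (p<a , _)             loose = <-loose p<a loose , tt
loose⇒atom≤ (suc m) p (a ∷ [])    (p<a , _)             loose = <-loose p<a loose , tt
loose⇒atom≤ (suc m) p (a ∷ b ∷ h) (p<a , 1+p<b , above) loose =
  <-loose p<a loose , 1+p<b , bottom-least (suc (suc p)) m h above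

atom≰bottom : ∀ m i p → i < m → ¬ Dom (heightGo p (atom m i)) (heightGo p (bottom m))
atom≰bottom (suc zero)    zero    p _         (2+p≤1+p , _) = 1+n≰n 2+p≤1+p
atom≰bottom (suc (suc m)) zero    p _         (2+p≤1+p , _) = 1+n≰n 2+p≤1+p
atom≰bottom (suc m)       (suc i) p (s≤s i<m) (_ , D)       = atom≰bottom m i (suc p) i<m D

aboveStaircase-drop : ∀ {k p} h → AboveStaircase (suc k) p h → AboveStaircase k (suc p) (drop 1 h)
aboveStaircase-drop []      _           = tt
aboveStaircase-drop (_ ∷ _) (_ , above) = above

dom-∷ : ∀ {k p H} h → AboveStaircase (suc k) p h → Dom H (drop 1 h) → Dom (suc p ∷ H) h
dom-∷ []      _         _ = tt
dom-∷ (_ ∷ _) (p<a , _) D = p<a , D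

atoms-separate : ∀ k p hx hz → AboveStaircase k p hx → AboveStaircase k p hz →
  (∀ i → i < k → Dom (heightGo p (atom k i)) hx → Dom (heightGo p (atom k i)) hz → ⊥) →
  ∁ (tightness k p hx) ⊆ tightness k p hz
atoms-separate zero    p hx hz _  _  _   = []
atoms-separate (suc k) p hx hz sx sz sep =
  head ∷ atoms-separate k (suc p) (drop 1 hx) (drop 1 hz) (aboveStaircase-drop hx sx) (aboveStaircase-drop hz sz)
    λ i i<k ax az → sep (suc i) (s≤s i<k) (dom-∷ hx sx ax) (dom-∷ hz sz az)
  where
  head : not (tight p hx) B.≤ tight p hz
  head with tight p hx in ex | tight p hz in ez
  ... | true  | _     = B.≤-minimum _
  ... | false | true  = B.≤-refl
  ... | false | false = ⊥-elim (sep zero (s≤s z≤n) (loose⇒atom≤ k p hx sx ex) (loose⇒atom≤ k p hz sz ez))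

balanced⇒InD : ∀ n w → length w ≡ 2 * n → Balanced 0 w → InD n w
balanced⇒InD n w len balanced = len , balanced⇒prefixBalanced 0 w balanced

length-bottom : ∀ m → length (bottom m) ≡ 2 * m
length-bottom zero    = refl
length-bottom (suc m) = trans (cong (2 +_) (length-bottom m)) (sym (*-suc 2 m))

length-atom : ∀ m i → i < m → length (atom m i) ≡ 2 * m
length-atom (suc zero)    zero    _         = refl
length-atom (suc (suc m)) zero    _         =
  trans (cong (4 +_) (length-bottom m)) (sym (trans (*-suc 2 (suc m)) (cong (2 +_) (*-suc 2 m))))
length-atom (suc m)       (suc i) (s≤s i<m) = trans (cong (2 +_) (length-atom m i i<m)) (sym (*-suc 2 m))

balanced-bottom : ∀ d m → Balanced d (bottom m)
balanced-bottom d zero    = tt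
balanced-bottom d (suc m) = balanced-bottom d m

balanced-atom : ∀ d m i → Balanced d (atom m i)
balanced-atom d zero          i       = tt
balanced-atom d (suc zero)    zero    = tt
balanced-atom d (suc (suc m)) zero    = balanced-bottom d m
balanced-atom d (suc m)       (suc i) = balanced-atom d m i

bottom∈D : ∀ n → InD n (bottom n)
bottom∈D n = balanced⇒InD n (bottom n) (length-bottom n) (balanced-bottom 0 n)

atom∈D : ∀ n i → i < n → InD n (atom n i)
atom∈D n i i<n = balanced⇒InD n (atom n i) (length-atom n i i<n) (balanced-atom 0 n i)

∁σ⊆σ⇒meetIsBottom : ∀ n x z → ∁ (σ n x) ⊆ σ n z → MeetIsBottom n x z
∁σ⊆σ⇒meetIsBottom n x z ∁x⊆z y y∈D y≤x y≤z t t∈D =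
  allTight⇒least n 0 (height y) (height t)
    (∁⊆⇒upper-bound-full ∁x⊆z (tightness-antitone n 0 y≤x (height-aboveStaircase {n} y∈D))
                   (tightness-antitone n 0 y≤z (height-aboveStaircase {n} y∈D)))
    (height-aboveStaircase {n} t∈D)

meetIsBottom⇒∁σ⊆σ : ∀ n x z → InD n x → InD n z → MeetIsBottom n x z → ∁ (σ n x) ⊆ σ n z
meetIsBottom⇒∁σ⊆σ n x z x∈D z∈D meet =
  atoms-separate n 0 (height x) (height z) (height-aboveStaircase {n} x∈D) (height-aboveStaircase {n} z∈D)
    λ i i<n a≤x a≤z → atom≰bottom n i 0 i<n (meet (atom n i) (atom∈D n i i<n) a≤x a≤z (bottom n) (bottom∈D n))

-- The greatest word with a given signature

-- a counts the loose positions not yet placed; a tight position closes them with the block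
-- u^(a+1) r^(a+1), whose a + 1 heights all equal that position's minimal height.
build : ℕ → List Bool → List Letter
build a []           = replicate (2 * a) u
build a (false ∷ bs) = build (suc a) bs
build a (true ∷ bs)  = replicate (suc a) u ++ replicate (suc a) r ++ build 0 bs

ρ : List Bool → List Letter
ρ = build 0

heightGo-u⁺ : ∀ k c → heightGo c (replicate (suc k) u) ≡ (c + suc k) ∷ []
heightGo-u⁺ zero    c = cong (_∷ []) (+-comm 1 c)
heightGo-u⁺ (suc k) c = trans (heightGo-u⁺ k (suc c)) (cong (_∷ []) (sym (+-suc c (suc k))))

heightGo-u*r : ∀ j c w → heightGo c (replicate j u ++ r ∷ w) ≡ heightGo (c + j) (r ∷ w)
heightGo-u*r zero          c w = cong (λ c → heightGo c (r ∷ w)) (sym (+-identityʳ c))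
heightGo-u*r (suc zero)    c w = cong (λ c → heightGo c (r ∷ w)) (+-comm 1 c)
heightGo-u*r (suc (suc j)) c w =
  trans (heightGo-u*r (suc j) (suc c) w) (cong (λ c → heightGo c (r ∷ w)) (sym (+-suc c (suc j))))

heightGo-r* : ∀ j c w → heightGo c (replicate j r ++ w) ≡ replicate j c ++ heightGo c w
heightGo-r* zero    c w = refl
heightGo-r* (suc j) c w = cong (c ∷_) (heightGo-r* j c w)

heightGo-block : ∀ a c w →
  heightGo c (replicate (suc a) u ++ replicate (suc a) r ++ w) ≡ replicate (suc a) (c + suc a) ++ heightGo (c + suc a) w
heightGo-block a c w = trans (heightGo-u*r (suc a) c (replicate a r ++ w)) (heightGo-r* (suc a) (c + suc a) w)

tightness-[] : ∀ k p → tightness k p [] ≡ replicate k false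
tightness-[] zero    p = refl
tightness-[] (suc k) p = cong (false ∷_) (tightness-[] k (suc p))

tightness-block : ∀ j k p H →
  tightness (j + suc k) p (replicate (suc j) (p + suc j) ++ H) ≡ replicate j false ++ true ∷ tightness k (p + suc j) H
tightness-block zero    k p H rewrite +-comm p 1 = cong (_∷ tightness k (suc p) H) (≡⇒≡ᵇ-true {suc p} refl)
tightness-block (suc j) k p H rewrite +-suc p (suc j) =
  cong₂ _∷_ (≢⇒≡ᵇ-false (m+1+n≢m p ∘ suc-injective)) (tightness-block j k (suc p) H)

++-replicate-∷ : ∀ {A : Set} a (x : A) xs → replicate a x ++ x ∷ xs ≡ replicate (suc a) x ++ xs
++-replicate-∷ zero    x xs = refl
++-replicate-∷ (suc a) x xs = cong (x ∷_) (++-replicate-∷ a x xs)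

final-run-loose : ∀ c a → (c + 2 * suc a ≡ᵇ suc c) ≡ false
final-run-loose c a = ≢⇒≡ᵇ-false λ e →
  m+1+n≢m c (suc-injective (trans (sym (+-suc c (suc (2 * a)))) (trans (cong (c +_) (sym (*-suc 2 a))) e)))

tightness-build : ∀ a bs c → tightness (a + length bs) c (heightGo c (build a bs)) ≡ replicate a false ++ bs
tightness-build zero    []           c = refl
tightness-build (suc a) []           c rewrite heightGo-u⁺ (a + suc (a + 0)) c =
  cong₂ _∷_ (final-run-loose c a)
    (trans (tightness-[] (a + 0) (suc c)) (trans (cong (λ k → replicate k false) (+-identityʳ a))
      (sym (++-identityʳ (replicate a false)))))
tightness-build a       (false ∷ bs) c = begin
  tightness (a + suc (length bs)) c (heightGo c (build (suc a) bs))
    ≡⟨ cong (λ k → tightness k c (heightGo c (build (suc a) bs))) (+-suc a (length bs)) ⟩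
  tightness (suc a + length bs) c (heightGo c (build (suc a) bs))
    ≡⟨ tightness-build (suc a) bs c ⟩
  replicate (suc a) false ++ bs
    ≡⟨ sym (++-replicate-∷ a false bs) ⟩
  replicate a false ++ false ∷ bs ∎
tightness-build a       (true ∷ bs)  c = begin
  tightness (a + suc (length bs)) c (heightGo c (build a (true ∷ bs)))
    ≡⟨ cong (tightness (a + suc (length bs)) c) (heightGo-block a c (build 0 bs)) ⟩
  tightness (a + suc (length bs)) c (replicate (suc a) (c + suc a) ++ heightGo (c + suc a) (build 0 bs))
    ≡⟨ tightness-block a (length bs) c _ ⟩
  replicate a false ++ true ∷ tightness (length bs) (c + suc a) (heightGo (c + suc a) (build 0 bs))
    ≡⟨ cong (λ t → replicate a false ++ true ∷ t) (tightness-build 0 bs (c + suc a)) ⟩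
  replicate a false ++ true ∷ bs ∎

σ-ρ : ∀ {n} T → length T ≡ n → σ n (ρ T) ≡ T
σ-ρ T refl = tightness-build 0 T 0

length-build : ∀ a bs → length (build a bs) ≡ 2 * (a + length bs)
length-build a []           = trans (length-replicate (2 * a)) (cong (2 *_) (sym (+-identityʳ a)))
length-build a (false ∷ bs) = trans (length-build (suc a) bs) (cong (2 *_) (sym (+-suc a (length bs))))
length-build a (true ∷ bs)  = begin
  length (replicate (suc a) u ++ replicate (suc a) r ++ build 0 bs)
    ≡⟨ length-++ (replicate (suc a) u) ⟩
  length (replicate (suc a) u) + length (replicate (suc a) r ++ build 0 bs)
    ≡⟨ cong₂ _+_ (length-replicate (suc a)) (length-++ (replicate (suc a) r)) ⟩
  suc a + (length (replicate (suc a) r) + length (build 0 bs))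
    ≡⟨ cong (λ k → suc a + (k + length (build 0 bs))) (length-replicate (suc a)) ⟩
  suc a + (suc a + length (build 0 bs))
    ≡⟨ cong (λ k → suc a + (suc a + k)) (length-build 0 bs) ⟩
  suc a + (suc a + 2 * length bs)
    ≡⟨ blocks a (length bs) ⟩
  2 * (a + suc (length bs)) ∎
  where
  blocks : ∀ a l → suc a + (suc a + 2 * l) ≡ 2 * (a + suc l)
  blocks = solve-∀

balanced-u* : ∀ j d w → Balanced (j + d) w → Balanced d (replicate j u ++ w)
balanced-u* zero    d w b = b
balanced-u* (suc j) d w b = balanced-u* j (suc d) w (subst (λ e → Balanced e w) (sym (+-suc j d)) b)

balanced-r* : ∀ j d w → Balanced d w → Balanced (j + d) (replicate j r ++ w)
balanced-r* zero    d w b = b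
balanced-r* (suc j) d w b = balanced-r* j d w b

balanced-build : ∀ d a bs → Balanced d (build a bs)
balanced-build d a []           = subst (Balanced d) (++-identityʳ (replicate (2 * a) u)) (balanced-u* (2 * a) d [] tt)
balanced-build d a (false ∷ bs) = balanced-build d (suc a) bs
balanced-build d a (true ∷ bs)  =
  balanced-u* (suc a) d _ (balanced-r* (suc a) d (build 0 bs) (balanced-build d 0 bs))

ρ∈D : ∀ n T → length T ≡ n → InD n (ρ T)
ρ∈D n T len = balanced⇒InD n (ρ T) (trans (length-build 0 T) (cong (2 *_) len)) (balanced-build 0 0 T)

allPairs-++ʳ : ∀ {A : Set} {R : A → A → Set} xs {ys} → AllPairs R (xs ++ ys) → AllPairs R ys
allPairs-++ʳ []       sorted       = sorted
allPairs-++ʳ (x ∷ xs) (_ ∷ sorted) = allPairs-++ʳ xs sorted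

dom-++ : ∀ {v H h₂} h₁ → All (_≤ v) h₁ → Dom h₂ H → Dom (h₁ ++ h₂) (replicate (length h₁) v ++ H)
dom-++ []       []          D = D
dom-++ (a ∷ h₁) (a≤v ∷ ≤v) D = a≤v , dom-++ h₁ ≤v D

-- By sortedness, the heights up to the first tight position of T are bounded by its height.
tight-prefix : ∀ a k c bs h → AllPairs _≤_ h →
  replicate a false ++ true ∷ bs ⊆ tightness (suc a + k) c h →
  Σ (List ℕ) λ h₁ → Σ (List ℕ) λ h₂ →
    h ≡ h₁ ++ h₂ × length h₁ ≡ suc a × All (_≤ c + suc a) h₁ × bs ⊆ tightness k (c + suc a) h₂
tight-prefix zero    k c bs []       _ (() ∷ _)
tight-prefix zero    k c bs (x ∷ h₂) _ (t ∷ rest) rewrite +-comm c 1 =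
  x ∷ [] , h₂ , refl , refl , ≤-reflexive (≡ᵇ-true (true≤⇒≡true t)) ∷ [] , rest
tight-prefix (suc a) k c bs []       _ (_ ∷ rest) with tight-prefix a k (suc c) bs [] [] rest
... | []    , _ , _  , () , _
... | _ ∷ _ , _ , () , _
tight-prefix (suc a) k c bs (x ∷ h)  (x≤ ∷ sorted) (_ ∷ rest) rewrite +-suc c (suc a)
  with tight-prefix a k (suc c) bs h sorted rest
... | []     , _  , _    , () , _
... | y ∷ h₁ , h₂ , refl , len , ≤v , sub =
  x ∷ y ∷ h₁ , h₂ , refl , cong suc len , ≤-trans (All.head x≤) (All.head ≤v) ∷ ≤v , sub

build-greatest : ∀ a bs m c h → a + length bs ≡ m → AllPairs _≤_ h → Antidiagonal (c + 2 * m) h →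
  (h ≡ [] → m ≡ 0) → replicate a false ++ bs ⊆ tightness m c h → Dom h (heightGo c (build a bs))
build-greatest zero    []           m c h       _    _      _ _        _ = tt
build-greatest (suc a) []           m c []      e    _      _ nonempty _ with trans e (nonempty refl)
... | ()
build-greatest (suc a) []           _ c (x ∷ h) refl _      A _        _
  rewrite heightGo-u⁺ (a + suc (a + 0)) c =
  subst (x ≤_) (cong (λ k → c + 2 * k) (+-identityʳ (suc a))) (antidiagonal-head h A) , tt
build-greatest a       (false ∷ bs) m c h       e    sorted A nonempty sub =
  build-greatest (suc a) bs m c h (trans (sym (+-suc a (length bs))) e) sorted A nonempty
    (subst (_⊆ tightness m c h) (++-replicate-∷ a false bs) sub)
build-greatest a       (true ∷ bs)  _ c h       refl sorted A nonempty sub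
  with tight-prefix a (length bs) c bs h sorted
         (subst (λ m → replicate a false ++ true ∷ bs ⊆ tightness m c h) (+-suc a (length bs)) sub)
... | h₁ , h₂ , refl , len₁ , ≤v , sub₂ rewrite heightGo-block a c (build 0 bs) =
  subst (λ k → Dom (h₁ ++ h₂) (replicate k v ++ heightGo v (build 0 bs))) len₁
    (dom-++ h₁ ≤v (build-greatest 0 bs l v h₂ refl (allPairs-++ʳ h₁ sorted)
      (antidiagonal-++ h₁ h₂ (subst (λ B → Antidiagonal B (h₁ ++ h₂)) budget A)) nonempty₂ sub₂))
  where
  v = c + suc a
  l = length bs
  budget : c + 2 * (a + suc l) ≡ length h₁ + (v + 2 * l)
  budget = trans (blocks c a l) (cong (_+ (v + 2 * l)) (sym len₁))
    where
    blocks : ∀ c a l → c + 2 * (a + suc l) ≡ suc a + ((c + suc a) + 2 * l)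
    blocks = solve-∀
  -- If h ended with this block, its last entry would lie too far below the antidiagonal.
  nonempty₂ : h₂ ≡ [] → l ≡ 0
  nonempty₂ refl = antidiagonal-slack l h₁ (subst (0 <_) (sym len₁) (s≤s z≤n)) ≤v
    (subst₂ Antidiagonal budget (++-identityʳ h₁) A)

ρ-greatest : ∀ n x T → InD n x → length T ≡ n → T ⊆ σ n x → x ≤D ρ T
ρ-greatest n x T x∈D refl T⊆σx =
  build-greatest 0 T (length T) 0 (height x) refl (heightGo-sorted 0 x) (height-antidiagonal {n} x∈D)
    (λ e → m+n≡0⇒m≡0 (length T) (trans (sym (proj₁ x∈D)) (cong length (heightGo-≡[] x e))))
    T⊆σx

-- Regular elements

dom-antisym : ∀ h h′ → Dom h h′ → Dom h′ h → h ≡ h′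
dom-antisym []      []        _           _           = refl
dom-antisym (a ∷ h) (b ∷ h′) (a≤b , D)  (b≤a , D′) = cong₂ _∷_ (≤-antisym a≤b b≤a) (dom-antisym h h′ D D′)

heightGo-u-≥ : ∀ c w → All (suc c ≤_) (heightGo c (u ∷ w))
heightGo-u-≥ c []      = ≤-refl ∷ []
heightGo-u-≥ c (x ∷ w) = heightGo-≥ (suc c) (x ∷ w)

heightGo-r≢u : ∀ c w w′ → heightGo c (r ∷ w) ≢ heightGo c (u ∷ w′)
heightGo-r≢u c w w′ e = 1+n≰n (All.head (subst (All (suc c ≤_)) (sym e) (heightGo-u-≥ c w′)))

heightGo-injective : ∀ c w w′ → length w ≡ length w′ → heightGo c w ≡ heightGo c w′ → w ≡ w′
heightGo-injective c []          []           _   _ = refl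
heightGo-injective c (r ∷ w)     (r ∷ w′)     len e =
  cong (r ∷_) (heightGo-injective c w w′ (suc-injective len) (∷-injectiveʳ e))
heightGo-injective c (r ∷ w)     (u ∷ w′)     _   e = ⊥-elim (heightGo-r≢u c w w′ e)
heightGo-injective c (u ∷ w)     (r ∷ w′)     _   e = ⊥-elim (heightGo-r≢u c w′ w (sym e))
heightGo-injective c (u ∷ [])    (u ∷ [])     _   _ = refl
heightGo-injective c (u ∷ x ∷ w) (u ∷ y ∷ w′) len e =
  cong (u ∷_) (heightGo-injective (suc c) (x ∷ w) (y ∷ w′) (suc-injective len) e)

≤D-antisym : ∀ n {x y} → InD n x → InD n y → x ≤D y → y ≤D x → x ≡ y
≤D-antisym n {x} {y} (len , _) (len′ , _) x≤y y≤x =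
  heightGo-injective 0 x y (trans len (sym len′)) (dom-antisym (height x) (height y) x≤y y≤x)

pseudocomplement : ∀ n x → InD n x → IsPseudocomplement n x (ρ (∁ (σ n x)))
pseudocomplement n x x∈D =
  ρ∈D n (∁ (σ n x)) length-∁σ ,
  ∁σ⊆σ⇒meetIsBottom n x (ρ (∁ (σ n x))) (subst (∁ (σ n x) ⊆_) (sym (σ-ρ (∁ (σ n x)) length-∁σ)) ⊆-refl) ,
  λ z z∈D x∧z → ρ-greatest n z (∁ (σ n x)) z∈D length-∁σ (meetIsBottom⇒∁σ⊆σ n x z x∈D z∈D x∧z)
  where
  length-∁σ : length (∁ (σ n x)) ≡ n
  length-∁σ = trans (length-map not (σ n x)) (length-σ n x)

ρ-regular : ∀ n T → length T ≡ n → Regular n (ρ T)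
ρ-regular n T len = ρ (∁ T) , complement , complement′
  where
  len∁ : length (∁ T) ≡ n
  len∁ = trans (length-map not T) len
  complement : IsPseudocomplement n (ρ T) (ρ (∁ T))
  complement = subst (λ S → IsPseudocomplement n (ρ T) (ρ (∁ S))) (σ-ρ T len)
    (pseudocomplement n (ρ T) (ρ∈D n T len))
  complement′ : IsPseudocomplement n (ρ (∁ T)) (ρ T)
  complement′ = subst (λ S → IsPseudocomplement n (ρ (∁ T)) (ρ S)) (trans (cong ∁ (σ-ρ (∁ T) len∁)) (∁-involutive T))
    (pseudocomplement n (ρ (∁ T)) (ρ∈D n (∁ T) len∁))

regular⇒≡ρσ : ∀ n x → InD n x → Regular n x → x ≡ ρ (σ n x)
regular⇒≡ρσ n x x∈D (c , (c∈D , x∧c , _) , (_ , _ , x-greatest)) =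
  ≤D-antisym n x∈D ρσ∈D (ρ-greatest n x (σ n x) x∈D (length-σ n x) ⊆-refl)
    (x-greatest (ρ (σ n x)) ρσ∈D (∁σ⊆σ⇒meetIsBottom n c (ρ (σ n x))
      (subst (∁ (σ n c) ⊆_) (sym (σ-ρ (σ n x) (length-σ n x))) (∁-⊆-swap (meetIsBottom⇒∁σ⊆σ n x c x∈D c∈D x∧c)))))
  where
  ρσ∈D : InD n (ρ (σ n x))
  ρσ∈D = ρ∈D n (σ n x) (length-σ n x)

ρ-injective : ∀ {T T′} → ρ T ≡ ρ T′ → T ≡ T′
ρ-injective {T} {T′} e = begin
  T                      ≡⟨ sym (σ-ρ T refl) ⟩
  σ (length T) (ρ T)     ≡⟨ cong (σ (length T)) e ⟩
  σ (length T) (ρ T′)    ≡⟨ σ-ρ T′ (sym len) ⟩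
  T′                     ∎
  where
  len : length T ≡ length T′
  len = *-cancelˡ-≡ _ _ 2 (trans (sym (length-build 0 T)) (trans (cong length e) (length-build 0 T′)))

-- Counting

bitLists : ℕ → List (List Bool)
bitLists zero    = [] ∷ []
bitLists (suc n) = map (true ∷_) (bitLists n) ++ map (false ∷_) (bitLists n)

∈-bitLists⁻ : ∀ n {v} → v ∈ bitLists n → length v ≡ n
∈-bitLists⁻ zero    (here refl) = refl
∈-bitLists⁻ (suc n) v∈ with ∈-++⁻ (map (true ∷_) (bitLists n)) v∈
... | inj₁ v∈t with ∈-map⁻ (true ∷_) v∈t
...   | v′ , v′∈ , refl = cong suc (∈-bitLists⁻ n v′∈)
∈-bitLists⁻ (suc n) v∈ | inj₂ v∈f with ∈-map⁻ (false ∷_) v∈f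
...   | v′ , v′∈ , refl = cong suc (∈-bitLists⁻ n v′∈)

∈-bitLists⁺ : ∀ n {v} → length v ≡ n → v ∈ bitLists n
∈-bitLists⁺ zero    {[]}        _   = here refl
∈-bitLists⁺ (suc n) {true ∷ v}  len = ∈-++⁺ˡ (∈-map⁺ (true ∷_) (∈-bitLists⁺ n (suc-injective len)))
∈-bitLists⁺ (suc n) {false ∷ v} len =
  ∈-++⁺ʳ (map (true ∷_) (bitLists n)) (∈-map⁺ (false ∷_) (∈-bitLists⁺ n (suc-injective len)))

bitLists-unique : ∀ n → Unique (bitLists n)
bitLists-unique zero    = [] ∷ []
bitLists-unique (suc n) =
  Unique.++⁺ (Unique.map⁺ ∷-injectiveʳ (bitLists-unique n)) (Unique.map⁺ ∷-injectiveʳ (bitLists-unique n)) disjoint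
  where
  disjoint : ∀ {v} → v ∈ map (true ∷_) (bitLists n) × v ∈ map (false ∷_) (bitLists n) → ⊥
  disjoint (v∈t , v∈f) with ∈-map⁻ (true ∷_) v∈t | ∈-map⁻ (false ∷_) v∈f
  ... | _ , _ , refl | _ , _ , ()

length-bitLists : ∀ n → length (bitLists n) ≡ 2 ^ n
length-bitLists zero    = refl
length-bitLists (suc n) = begin
  length (map (true ∷_) (bitLists n) ++ map (false ∷_) (bitLists n))
    ≡⟨ length-++ (map (true ∷_) (bitLists n)) ⟩
  length (map (true ∷_) (bitLists n)) + length (map (false ∷_) (bitLists n))
    ≡⟨ cong₂ _+_ (length-map (true ∷_) (bitLists n)) (length-map (false ∷_) (bitLists n)) ⟩
  length (bitLists n) + length (bitLists n)
    ≡⟨ cong₂ _+_ (length-bitLists n) (trans (length-bitLists n) (sym (+-identityʳ (2 ^ n)))) ⟩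
  2 ^ suc n ∎

corollary3p17 : (n : ℕ) → 0 < n → Σ (List (List Letter)) λ L →
    Unique L × (∀ w → (w ∈ L) ⇔ (InD n w × Regular n w)) × (length L ≡ 2 ^ n)
corollary3p17 n _ =
  map ρ (bitLists n) ,
  Unique.map⁺ ρ-injective (bitLists-unique n) ,
  (λ w → mk⇔ (listed⇒regular w) (regular⇒listed w)) ,
  trans (length-map ρ (bitLists n)) (length-bitLists n)
  where
  listed⇒regular : ∀ w → w ∈ map ρ (bitLists n) → InD n w × Regular n w
  listed⇒regular w w∈ with ∈-map⁻ ρ w∈
  ... | T , T∈ , refl = ρ∈D n T (∈-bitLists⁻ n T∈) , ρ-regular n T (∈-bitLists⁻ n T∈)
  regular⇒listed : ∀ w → InD n w × Regular n w → w ∈ map ρ (bitLists n)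
  regular⇒listed w (w∈D , regular) =
    subst (_∈ map ρ (bitLists n)) (sym (regular⇒≡ρσ n w w∈D regular)) (∈-map⁺ ρ (∈-bitLists⁺ n {σ n w} (length-σ n w)))
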